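{- Fix an integer $n\ge0$ and integers $x_0,y_0$ with $x_0+y_0\ge0$. If $F'(x_0,y_0+1)\le F'(x_0-1,y_0+2)\le F'(x_0-2,y_0+3)$, then $F'(x_0,y_0+2)\le F'(x_0-1,y_0+3)$. Similarly, if $F'(x_0,y_0+1)\ge F'(x_0-1,y_0+2)\ge F'(x_0-2,y_0+3)$, then $F'(x_0,y_0+2)\ge F'(x_0-1,y_0+3)$.
   Context: For a fixed integer $n\ge0$, define $F:\mathbb{Z}^2\to\mathbb{Z}_{\ge0}$ by $F(0,0)=2^n$, $F(x,y)=\lfloor F(x-1,y)/2\rfloor+\lfloor F(x,y-1)/2\rfloor$ for every $(x,y)\in\mathbb{Z}_{\ge0}^2\setminus\{(0,0)\}$, and $F(x,y)=0$ for $(x,y)$ outside the first quadrant (the intermediate firing configuration of chip-firing on the quadrant lattice graph started with $2^n$ chips at the origin). The difference table is $F'(x,y)=F(x-1,y)-F(x,y-1)$ for $(x,y)\in\mathbb{Z}^2$. -}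

module Defs where

open import Data.Nat using (ℕ; zero; suc; _+_; _^_; _/_)
open import Data.Integer using (ℤ; +_; -[1+_]; _-_)

-- F restricted to the first quadrant: Fℕ n x y = F(x,y) for x,y ≥ 0,
-- with F(0,0) = 2^n and F(x,y) = ⌊F(x-1,y)/2⌋ + ⌊F(x,y-1)/2⌋,
-- where values outside the quadrant are 0.
Fℕ : ℕ → ℕ → ℕ → ℕ
Fℕ n zero    zero    = 2 ^ n
Fℕ n (suc x) zero    = Fℕ n x zero / 2
Fℕ n zero    (suc y) = Fℕ n zero y / 2
Fℕ n (suc x) (suc y) = Fℕ n x (suc y) / 2 + Fℕ n (suc x) y / 2

F : ℕ → ℤ → ℤ → ℕ
F n (+ x) (+ y) = Fℕ n x y
F n (+ x) -[1+ y ] = 0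
F n -[1+ x ] y = 0

F′ : ℕ → ℤ → ℤ → ℤ
F′ n x y = (+ F n (x - + 1) y) - (+ F n x (y - + 1))

-- Write a, b, c, d for the values of F along the antidiagonal through (x₀, y₀).  One
-- antidiagonal up, F′ takes the values b − a, c − b, d − c, so the hypothesis is discrete
-- convexity: 2b ≤ a + c and 2c ≤ b + d.  By the firing rule, F itself there takes the values
-- ⌊b/2⌋ + ⌊a/2⌋, ⌊c/2⌋ + ⌊b/2⌋, ⌊d/2⌋ + ⌊c/2⌋, whose differences telescope, so the claim is
-- ⌊b/2⌋ + ⌊c/2⌋ ≤ ⌊a/2⌋ + ⌊d/2⌋.  Now 2b ≤ a + c gives b ≤ ⌊a/2⌋ + ⌈c/2⌉, and likewise
-- c ≤ ⌊d/2⌋ + ⌈b/2⌉; add these and cancel ⌈b/2⌉ + ⌈c/2⌉ using n = ⌊n/2⌋ + ⌈n/2⌉.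
-- The concave case is dual.
module Submission where

open import Defs
open import Data.Nat using (ℕ; zero; suc; _/_; ⌊_/2⌋; ⌈_/2⌉; s≤s; z≤n)
  renaming (_+_ to _+ℕ_; _≤_ to _≤ℕ_)
open import Data.Nat.Properties as ℕ
  using (⌊n/2⌋≤⌈n/2⌉; ⌊n/2⌋-mono; ⌈n/2⌉-mono; ⌊n/2⌋+⌈n/2⌉≡n; n≡⌊n+n/2⌋; n≡⌈n+n/2⌉)
open import Data.Nat.DivMod using (m/n≡1+[m∸n]/n)
open import Algebra.Properties.CommutativeSemigroup ℕ.+-commutativeSemigroup using (interchange)
open import Data.Integer using (ℤ; +_; -[1+_]; _+_; _-_; -_; _≤_; _≥_; +≤+)
open import Data.Integer.Properties using (+-monoˡ-≤; drop‿+≤+)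
import Data.Integer.Properties as ℤ
open import Data.Integer.Tactic.RingSolver using (solve-∀)
open import Data.Product using (_×_; _,_)
open import Data.Empty using (⊥-elim)
open import Relation.Nullary using (¬_)
open import Relation.Binary.PropositionalEquality
  using (_≡_; refl; sym; trans; cong; cong₂; subst; subst₂)

n/2≡⌊n/2⌋ : ∀ n → n / 2 ≡ ⌊ n /2⌋
n/2≡⌊n/2⌋ zero          = refl
n/2≡⌊n/2⌋ (suc zero)    = refl
n/2≡⌊n/2⌋ (suc (suc n)) =
  trans (m/n≡1+[m∸n]/n {suc (suc n)} {2} (s≤s (s≤s z≤n))) (cong suc (n/2≡⌊n/2⌋ n))

⌊m+n/2⌋≤⌊m/2⌋+⌈n/2⌉ : ∀ m n → ⌊ m +ℕ n /2⌋ ≤ℕ ⌊ m /2⌋ +ℕ ⌈ n /2⌉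
⌊m+n/2⌋≤⌊m/2⌋+⌈n/2⌉ zero          n = ⌊n/2⌋≤⌈n/2⌉ n
⌊m+n/2⌋≤⌊m/2⌋+⌈n/2⌉ (suc zero)    n = ℕ.≤-refl
⌊m+n/2⌋≤⌊m/2⌋+⌈n/2⌉ (suc (suc m)) n = s≤s (⌊m+n/2⌋≤⌊m/2⌋+⌈n/2⌉ m n)

⌊m/2⌋+⌈n/2⌉≤⌈m+n/2⌉ : ∀ m n → ⌊ m /2⌋ +ℕ ⌈ n /2⌉ ≤ℕ ⌈ m +ℕ n /2⌉
⌊m/2⌋+⌈n/2⌉≤⌈m+n/2⌉ zero          n = ℕ.≤-refl
⌊m/2⌋+⌈n/2⌉≤⌈m+n/2⌉ (suc zero)    n = ⌈n/2⌉-mono (ℕ.n≤1+n n)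
⌊m/2⌋+⌈n/2⌉≤⌈m+n/2⌉ (suc (suc m)) n = s≤s (⌊m/2⌋+⌈n/2⌉≤⌈m+n/2⌉ m n)

module _ (a b c : ℕ) where
  open ℕ.≤-Reasoning

  b+b≤a+c⇒b≤⌊a/2⌋+⌈c/2⌉ : b +ℕ b ≤ℕ a +ℕ c → b ≤ℕ ⌊ a /2⌋ +ℕ ⌈ c /2⌉
  b+b≤a+c⇒b≤⌊a/2⌋+⌈c/2⌉ b+b≤a+c = begin
    b                   ≡⟨ n≡⌊n+n/2⌋ b ⟩
    ⌊ b +ℕ b /2⌋        ≤⟨ ⌊n/2⌋-mono b+b≤a+c ⟩
    ⌊ a +ℕ c /2⌋        ≤⟨ ⌊m+n/2⌋≤⌊m/2⌋+⌈n/2⌉ a c ⟩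
    ⌊ a /2⌋ +ℕ ⌈ c /2⌉  ∎

  a+c≤b+b⇒⌊a/2⌋+⌈c/2⌉≤b : a +ℕ c ≤ℕ b +ℕ b → ⌊ a /2⌋ +ℕ ⌈ c /2⌉ ≤ℕ b
  a+c≤b+b⇒⌊a/2⌋+⌈c/2⌉≤b a+c≤b+b = begin
    ⌊ a /2⌋ +ℕ ⌈ c /2⌉  ≤⟨ ⌊m/2⌋+⌈n/2⌉≤⌈m+n/2⌉ a c ⟩
    ⌈ a +ℕ c /2⌉        ≤⟨ ⌈n/2⌉-mono a+c≤b+b ⟩
    ⌈ b +ℕ b /2⌉        ≡⟨ n≡⌈n+n/2⌉ b ⟨
    b                   ∎

module _ (a b c d : ℕ) where
  private
    ⌈b⌉+⌈c⌉ : ℕ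
    ⌈b⌉+⌈c⌉ = ⌈ b /2⌉ +ℕ ⌈ c /2⌉

    b+c≡⌊b⌋+⌊c⌋+⌈b⌉+⌈c⌉ : b +ℕ c ≡ (⌊ b /2⌋ +ℕ ⌊ c /2⌋) +ℕ ⌈b⌉+⌈c⌉
    b+c≡⌊b⌋+⌊c⌋+⌈b⌉+⌈c⌉ = trans (sym (cong₂ _+ℕ_ (⌊n/2⌋+⌈n/2⌉≡n b) (⌊n/2⌋+⌈n/2⌉≡n c)))
                                (interchange ⌊ b /2⌋ ⌈ b /2⌉ ⌊ c /2⌋ ⌈ c /2⌉)

    regroup : (⌊ a /2⌋ +ℕ ⌈ c /2⌉) +ℕ (⌊ d /2⌋ +ℕ ⌈ b /2⌉) ≡ (⌊ a /2⌋ +ℕ ⌊ d /2⌋) +ℕ ⌈b⌉+⌈c⌉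
    regroup = trans (interchange ⌊ a /2⌋ ⌈ c /2⌉ ⌊ d /2⌋ ⌈ b /2⌉)
                    (cong (⌊ a /2⌋ +ℕ ⌊ d /2⌋ +ℕ_) (ℕ.+-comm ⌈ c /2⌉ ⌈ b /2⌉))

  open ℕ.≤-Reasoning

  ⌊/2⌋-convex : b +ℕ b ≤ℕ a +ℕ c → c +ℕ c ≤ℕ b +ℕ d →
                ⌊ b /2⌋ +ℕ ⌊ c /2⌋ ≤ℕ ⌊ a /2⌋ +ℕ ⌊ d /2⌋
  ⌊/2⌋-convex b+b≤a+c c+c≤b+d = ℕ.+-cancelʳ-≤ ⌈b⌉+⌈c⌉ _ _ (begin
    (⌊ b /2⌋ +ℕ ⌊ c /2⌋) +ℕ ⌈b⌉+⌈c⌉              ≡⟨ b+c≡⌊b⌋+⌊c⌋+⌈b⌉+⌈c⌉ ⟨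
    b +ℕ c                                       ≤⟨ ℕ.+-mono-≤ (b+b≤a+c⇒b≤⌊a/2⌋+⌈c/2⌉ a b c b+b≤a+c)
                                                     (b+b≤a+c⇒b≤⌊a/2⌋+⌈c/2⌉ d c b c+c≤d+b) ⟩
    (⌊ a /2⌋ +ℕ ⌈ c /2⌉) +ℕ (⌊ d /2⌋ +ℕ ⌈ b /2⌉) ≡⟨ regroup ⟩
    (⌊ a /2⌋ +ℕ ⌊ d /2⌋) +ℕ ⌈b⌉+⌈c⌉              ∎)
    where
    c+c≤d+b : c +ℕ c ≤ℕ d +ℕ b
    c+c≤d+b = subst (c +ℕ c ≤ℕ_) (ℕ.+-comm b d) c+c≤b+d

  ⌊/2⌋-concave : a +ℕ c ≤ℕ b +ℕ b → b +ℕ d ≤ℕ c +ℕ c →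
                 ⌊ a /2⌋ +ℕ ⌊ d /2⌋ ≤ℕ ⌊ b /2⌋ +ℕ ⌊ c /2⌋
  ⌊/2⌋-concave a+c≤b+b b+d≤c+c = ℕ.+-cancelʳ-≤ ⌈b⌉+⌈c⌉ _ _ (begin
    (⌊ a /2⌋ +ℕ ⌊ d /2⌋) +ℕ ⌈b⌉+⌈c⌉              ≡⟨ regroup ⟨
    (⌊ a /2⌋ +ℕ ⌈ c /2⌉) +ℕ (⌊ d /2⌋ +ℕ ⌈ b /2⌉) ≤⟨ ℕ.+-mono-≤ (a+c≤b+b⇒⌊a/2⌋+⌈c/2⌉≤b a b c a+c≤b+b)
                                                     (a+c≤b+b⇒⌊a/2⌋+⌈c/2⌉≤b d c b d+b≤c+c) ⟩
    b +ℕ c                                       ≡⟨ b+c≡⌊b⌋+⌊c⌋+⌈b⌉+⌈c⌉ ⟩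
    (⌊ b /2⌋ +ℕ ⌊ c /2⌋) +ℕ ⌈b⌉+⌈c⌉              ∎)
    where
    d+b≤c+c : d +ℕ b ≤ℕ c +ℕ c
    d+b≤c+c = subst (_≤ℕ c +ℕ c) (ℕ.+-comm b d) b+d≤c+c

module _ (m n o p : ℕ) where
  private
    i-j+[j+l]≡l+i : ∀ i j l → (i - j) + (j + l) ≡ l + i
    i-j+[j+l]≡l+i = solve-∀
    k-l+[j+l]≡j+k : ∀ j k l → (k - l) + (j + l) ≡ j + k
    k-l+[j+l]≡j+k = solve-∀
    l+i-[j+l]≡i-j : ∀ i j l → (l + i) - (j + l) ≡ i - j
    l+i-[j+l]≡i-j = solve-∀
    j+k-[j+l]≡k-l : ∀ j k l → (j + k) - (j + l) ≡ k - l
    j+k-[j+l]≡k-l = solve-∀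

  m-n≤o-p⇒p+m≤n+o : + m - + n ≤ + o - + p → p +ℕ m ≤ℕ n +ℕ o
  m-n≤o-p⇒p+m≤n+o m-n≤o-p = drop‿+≤+ (subst₂ _≤_
    (i-j+[j+l]≡l+i (+ m) (+ n) (+ p)) (k-l+[j+l]≡j+k (+ n) (+ o) (+ p))
    (+-monoˡ-≤ (+ n + + p) m-n≤o-p))

  p+m≤n+o⇒m-n≤o-p : p +ℕ m ≤ℕ n +ℕ o → + m - + n ≤ + o - + p
  p+m≤n+o⇒m-n≤o-p p+m≤n+o = subst₂ _≤_
    (l+i-[j+l]≡i-j (+ m) (+ n) (+ p)) (j+k-[j+l]≡k-l (+ n) (+ o) (+ p))
    (+-monoˡ-≤ (- (+ n + + p)) (+≤+ p+m≤n+o))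

Δ : (ℕ → ℕ) → ℕ → ℤ
Δ f k = + f (suc k) - + f k

fire : (ℕ → ℕ) → ℕ → ℕ
fire f k = f (suc k) / 2 +ℕ f k / 2

Δ-fire : ∀ f k → Δ (fire f) k ≡ + ⌊ f (2 +ℕ k) /2⌋ - + ⌊ f k /2⌋
Δ-fire f k = trans
  (cong₂ (λ s t → + s - + t) (cong₂ _+ℕ_ (n/2≡⌊n/2⌋ (f (2 +ℕ k))) (n/2≡⌊n/2⌋ (f (1 +ℕ k))))
                             (cong₂ _+ℕ_ (n/2≡⌊n/2⌋ (f (1 +ℕ k))) (n/2≡⌊n/2⌋ (f k))))
  (i+j-[j+k]≡i-k (+ ⌊ f (2 +ℕ k) /2⌋) (+ ⌊ f (1 +ℕ k) /2⌋) (+ ⌊ f k /2⌋))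
  where
  i+j-[j+k]≡i-k : ∀ i j k → (i + j) - (j + k) ≡ i - k
  i+j-[j+k]≡i-k = solve-∀

module _ (f : ℕ → ℕ) (k : ℕ) where
  open ℤ.≤-Reasoning
  private
    a b c d : ℕ
    a = f k
    b = f (1 +ℕ k)
    c = f (2 +ℕ k)
    d = f (3 +ℕ k)

  fire-convex : Δ f k ≤ Δ f (1 +ℕ k) → Δ f (1 +ℕ k) ≤ Δ f (2 +ℕ k) →
                Δ (fire f) k ≤ Δ (fire f) (1 +ℕ k)
  fire-convex ab≤bc bc≤cd = begin
    Δ (fire f) k            ≡⟨ Δ-fire f k ⟩
    + ⌊ c /2⌋ - + ⌊ a /2⌋   ≤⟨ p+m≤n+o⇒m-n≤o-p ⌊ c /2⌋ ⌊ a /2⌋ ⌊ d /2⌋ ⌊ b /2⌋ halves-convex ⟩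
    + ⌊ d /2⌋ - + ⌊ b /2⌋   ≡⟨ Δ-fire f (1 +ℕ k) ⟨
    Δ (fire f) (1 +ℕ k)     ∎
    where
    halves-convex : ⌊ b /2⌋ +ℕ ⌊ c /2⌋ ≤ℕ ⌊ a /2⌋ +ℕ ⌊ d /2⌋
    halves-convex = ⌊/2⌋-convex a b c d
      (m-n≤o-p⇒p+m≤n+o b a c b ab≤bc) (m-n≤o-p⇒p+m≤n+o c b d c bc≤cd)

  fire-concave : Δ f (1 +ℕ k) ≤ Δ f k → Δ f (2 +ℕ k) ≤ Δ f (1 +ℕ k) →
                 Δ (fire f) (1 +ℕ k) ≤ Δ (fire f) k
  fire-concave bc≤ab cd≤bc = begin
    Δ (fire f) (1 +ℕ k)     ≡⟨ Δ-fire f (1 +ℕ k) ⟩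
    + ⌊ d /2⌋ - + ⌊ b /2⌋   ≤⟨ p+m≤n+o⇒m-n≤o-p ⌊ d /2⌋ ⌊ b /2⌋ ⌊ c /2⌋ ⌊ a /2⌋ halves-concave ⟩
    + ⌊ c /2⌋ - + ⌊ a /2⌋   ≡⟨ Δ-fire f k ⟨
    Δ (fire f) k            ∎
    where
    halves-concave : ⌊ a /2⌋ +ℕ ⌊ d /2⌋ ≤ℕ ⌊ b /2⌋ +ℕ ⌊ c /2⌋
    halves-concave = ⌊/2⌋-concave a b c d
      (m-n≤o-p⇒p+m≤n+o c b b a bc≤ab) (m-n≤o-p⇒p+m≤n+o d c c b cd≤bc)

F-recurrence : ∀ n x y → ¬ (x ≡ + 0 × y ≡ + 0) →
               F n x y ≡ F n (x - + 1) y / 2 +ℕ F n x (y - + 1) / 2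
F-recurrence n (+ zero)  (+ zero)  ≢origin = ⊥-elim (≢origin (refl , refl))
F-recurrence n (+ suc i) (+ zero)  _       = sym (ℕ.+-identityʳ _)
F-recurrence n (+ zero)  (+ suc j) _       = refl
F-recurrence n (+ suc i) (+ suc j) _       = refl
F-recurrence n (+ zero)  -[1+ j ]  _       = refl
F-recurrence n (+ suc i) -[1+ j ]  _       = refl
F-recurrence n -[1+ i ]  y         _       = refl

0≤[x-1]+y⇒≢origin : ∀ {x y} → + 0 ≤ (x - + 1) + y → ¬ (x ≡ + 0 × y ≡ + 0)
0≤[x-1]+y⇒≢origin () (refl , refl)

module Antidiagonal (n : ℕ) (x₀ y₀ : ℤ) (x₀+y₀≥0 : x₀ + y₀ ≥ + 0) where
  -- Offset 0 is x₀ (resp. y₀) itself rather than x₀ - + 0, so that X k and Y k are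
  -- syntactically the coordinates occurring in the statement.
  X Y : ℕ → ℤ
  X zero    = x₀
  X (suc k) = x₀ - + suc k
  Y zero    = y₀
  Y (suc k) = y₀ + + suc k

  private
    i-j-1≡i-[1+j] : ∀ i j → i - j - + 1 ≡ i - (+ 1 + j)
    i-j-1≡i-[1+j] = solve-∀
    i+1-1≡i : ∀ i → i + + 1 - + 1 ≡ i
    i+1-1≡i = solve-∀
    i+[1+j]-1≡i+j : ∀ i j → i + (+ 1 + j) - + 1 ≡ i + j
    i+[1+j]-1≡i+j = solve-∀
    i-k+[j+k]≡i+j : ∀ i j k → (i - k) + (j + k) ≡ i + j
    i-k+[j+k]≡i+j = solve-∀

  X[k]-1≡X[1+k] : ∀ k → X k - + 1 ≡ X (suc k)
  X[k]-1≡X[1+k] zero    = refl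
  X[k]-1≡X[1+k] (suc k) = i-j-1≡i-[1+j] x₀ (+ suc k)

  Y[1+k]-1≡Y[k] : ∀ k → Y (suc k) - + 1 ≡ Y k
  Y[1+k]-1≡Y[k] zero    = i+1-1≡i y₀
  Y[1+k]-1≡Y[k] (suc k) = i+[1+j]-1≡i+j y₀ (+ suc k)

  0≤X+Y : ∀ k → + 0 ≤ X k + Y k
  0≤X+Y zero    = x₀+y₀≥0
  0≤X+Y (suc k) = subst (+ 0 ≤_) (sym (i-k+[j+k]≡i+j x₀ y₀ (+ suc k))) x₀+y₀≥0

  diagonal above : ℕ → ℕ
  diagonal k = F n (X k) (Y k)
  above    k = F n (X k) (Y (suc k))

  F′-grid : ∀ k j →
            F′ n (X k) (Y (suc j)) ≡ + F n (X (suc k)) (Y (suc j)) - + F n (X k) (Y j)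
  F′-grid k j = cong₂ (λ x′ y′ → + F n x′ (Y (suc j)) - + F n (X k) y′)
                      (X[k]-1≡X[1+k] k) (Y[1+k]-1≡Y[k] j)

  F′-above-diagonal : ∀ k → F′ n (X k) (Y (suc k)) ≡ Δ diagonal k
  F′-above-diagonal k = F′-grid k k

  above≡fire-diagonal : ∀ k → above k ≡ fire diagonal k
  above≡fire-diagonal k = trans (F-recurrence n (X k) (Y (suc k)) ≢origin)
    (cong₂ (λ x′ y′ → F n x′ (Y (suc k)) / 2 +ℕ F n (X k) y′ / 2)
           (X[k]-1≡X[1+k] k) (Y[1+k]-1≡Y[k] k))
    where
    ≢origin : ¬ (X k ≡ + 0 × Y (suc k) ≡ + 0)
    ≢origin = 0≤[x-1]+y⇒≢origin
      (subst (λ x → + 0 ≤ x + Y (suc k)) (sym (X[k]-1≡X[1+k] k)) (0≤X+Y (suc k)))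

  F′-two-above-diagonal : ∀ k → F′ n (X k) (Y (2 +ℕ k)) ≡ Δ (fire diagonal) k
  F′-two-above-diagonal k = trans (F′-grid k (suc k))
    (cong₂ (λ s t → + s - + t) (above≡fire-diagonal (suc k)) (above≡fire-diagonal k))

lemma9p7 : (n : ℕ) (x₀ y₀ : ℤ) → x₀ + y₀ ≥ + 0 →
    ((F′ n x₀ (y₀ + + 1) ≤ F′ n (x₀ - + 1) (y₀ + + 2) →
      F′ n (x₀ - + 1) (y₀ + + 2) ≤ F′ n (x₀ - + 2) (y₀ + + 3) →
      F′ n x₀ (y₀ + + 2) ≤ F′ n (x₀ - + 1) (y₀ + + 3))
    × (F′ n x₀ (y₀ + + 1) ≥ F′ n (x₀ - + 1) (y₀ + + 2) →
      F′ n (x₀ - + 1) (y₀ + + 2) ≥ F′ n (x₀ - + 2) (y₀ + + 3) →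
      F′ n x₀ (y₀ + + 2) ≥ F′ n (x₀ - + 1) (y₀ + + 3)))
lemma9p7 n x₀ y₀ x₀+y₀≥0 =
    (λ ab≤bc bc≤cd → subst₂ _≤_ (sym (F′-two-above-diagonal 0)) (sym (F′-two-above-diagonal 1))
       (fire-convex diagonal 0 (subst₂ _≤_ (F′-above-diagonal 0) (F′-above-diagonal 1) ab≤bc)
                               (subst₂ _≤_ (F′-above-diagonal 1) (F′-above-diagonal 2) bc≤cd)))
  , (λ bc≤ab cd≤bc → subst₂ _≤_ (sym (F′-two-above-diagonal 1)) (sym (F′-two-above-diagonal 0))
       (fire-concave diagonal 0 (subst₂ _≤_ (F′-above-diagonal 1) (F′-above-diagonal 0) bc≤ab)
                                (subst₂ _≤_ (F′-above-diagonal 2) (F′-above-diagonal 1) cd≤bc)))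
  where open Antidiagonal n x₀ y₀ x₀+y₀≥0
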